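{- Let $t,u$ be $\mathrm{BCCS}(A)$ terms, $\sigma$ a closed substitution, $a\in A$ and $m$ an integer such that (1) $t\equiv_{\rm WIF}u$; (2) $m>|u|$; (3) $\mathcal{CT}(\sigma(u))\subseteq\{a^m,a^{2m}\}$; (4) there is a closed term $p'$ with $\sigma(t)\Rightarrow\xrightarrow{\tau}p'$ and $\mathcal{CT}(p')=\{a^{2m}\}$. Then there is a closed term $q'$ with $\sigma(u)\Rightarrow\xrightarrow{\tau}q'$ and $\mathcal{CT}(q')=\{a^{2m}\}$.
   Context: $\mathrm{BCCS}(A)$: $A$ nonempty set of visible actions, $\tau\notin A$, countably infinite variable set $V$; terms $t::=\mathbf{0}\mid\alpha t\mid t+t\mid x$, $\alpha\in A\cup\{\tau\}$. Depth: $|\mathbf{0}|=|x|=0$, $|bt|=1+|t|$ for $b\in A$, $|\tau t|=|t|$, $|t+u|=\max(|t|,|u|)$. Transitions: $\alpha t\xrightarrow{\alpha}t$; if $t\xrightarrow{\alpha}t'$ then $t+u\xrightarrow{\alpha}t'$, $u+t\xrightarrow{\alpha}t'$; variables have no transitions. $\Rightarrow$: zero or more $\tau$-steps; $t\Rightarrow\xrightarrow{\tau}t'$ means $t\Rightarrow v\xrightarrow{\tau}t'$ for some $v$. $\mathcal{I}(p)=\{b\in A\mid p\Rightarrow\xrightarrow{b}\}$. A sequence $a_1\cdots a_k\in A^*$ is a trace of closed $p_0$ if $p_0\Rightarrow\xrightarrow{a_1}\Rightarrow\cdots\Rightarrow\xrightarrow{a_k}\Rightarrow p_k$, and a completed trace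 if moreover $\mathcal{I}(p_k)=\emptyset$; $\mathcal{T}(p)$, $\mathcal{CT}(p)$ denote these sets. $(a_1\cdots a_k,B)$ with $B\subseteq A^*$ is a weak impossible future of $p_0$ if there is such a path with $\mathcal{T}(p_k)\cap B=\emptyset$. $p\sqsubseteq_{\rm WIF}q$ iff (1) every weak impossible future of $p$ is one of $q$, (2) $\mathcal{T}(p)=\mathcal{T}(q)$, (3) $p\xrightarrow{\tau}$ implies $q\xrightarrow{\tau}$; $\equiv_{\rm WIF}=\sqsubseteq_{\rm WIF}\cap\sqsubseteq_{\rm WIF}^{ -1}$; for open terms, via all closed substitutions. $a^n$ denotes the sequence of $n$ copies of $a$. -}

module Defs where

open import Data.Nat using (ℕ; zero; suc; _⊔_)
open import Data.List using (List; []; _∷_)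
open import Data.Product using (Σ; ∃; _×_; _,_)
open import Data.Empty using (⊥)
open import Data.Unit using (⊤)
open import Relation.Nullary using (¬_)

data Act (A : Set) : Set where
  τ   : Act A
  vis : A → Act A

Var : Set
Var = ℕ

data Term (A : Set) : Set where
  𝟎   : Term A
  _·_ : Act A → Term A → Term A
  _⊕_ : Term A → Term A → Term A
  var : Var → Term A

infixr 7 _·_
infixl 6 _⊕_

module _ {A : Set} where

  Closed : Term A → Set
  Closed 𝟎       = ⊤
  Closed (α · t) = Closed t
  Closed (t ⊕ u) = Closed t × Closed u
  Closed (var x) = ⊥

  depth : Term A → ℕ
  depth 𝟎             = 0
  depth (τ · t)       = depth t
  depth (vis b · t)   = suc (depth t)
  depth (t ⊕ u)       = depth t ⊔ depth u
  depth (var x)       = 0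

  Subst : Set
  Subst = Var → Term A

  ClosedSubst : Subst → Set
  ClosedSubst σ = ∀ x → Closed (σ x)

  _[_] : Term A → Subst → Term A
  𝟎       [ σ ] = 𝟎
  (α · t) [ σ ] = α · (t [ σ ])
  (t ⊕ u) [ σ ] = (t [ σ ]) ⊕ (u [ σ ])
  var x   [ σ ] = σ x

  data _—[_]→_ : Term A → Act A → Term A → Set where
    pre  : ∀ {α t} → (α · t) —[ α ]→ t
    sumˡ : ∀ {t u α t'} → t —[ α ]→ t' → (t ⊕ u) —[ α ]→ t'
    sumʳ : ∀ {t u α t'} → t —[ α ]→ t' → (u ⊕ t) —[ α ]→ t'

  data _⇒_ : Term A → Term A → Set where
    ⇒-refl : ∀ {p} → p ⇒ p
    ⇒-step : ∀ {p p' q} → p —[ τ ]→ p' → p' ⇒ q → p ⇒ q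

  _⇒τ→_ : Term A → Term A → Set
  p ⇒τ→ q = ∃ λ v → (p ⇒ v) × (v —[ τ ]→ q)

  data WPath : Term A → List A → Term A → Set where
    wnil  : ∀ {p q} → p ⇒ q → WPath p [] q
    wcons : ∀ {p p₁ p₂ q a s} → p ⇒ p₁ → p₁ —[ vis a ]→ p₂ → WPath p₂ s q →
            WPath p (a ∷ s) q

  Init : Term A → A → Set
  Init p b = ∃ λ p₁ → ∃ λ p₂ → (p ⇒ p₁) × (p₁ —[ vis b ]→ p₂)

  Trace : Term A → List A → Set
  Trace p s = ∃ λ q → WPath p s q

  CTrace : Term A → List A → Set
  CTrace p s = ∃ λ q → WPath p s q × (∀ b → ¬ Init q b)

  WIF : Term A → List A → (List A → Set) → Set
  WIF p s B = ∃ λ q → WPath p s q × (∀ w → Trace q w → ¬ B w)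

  _⊑WIF_ : Term A → Term A → Set₁
  p ⊑WIF q =
    (∀ s (B : List A → Set) → WIF p s B → WIF q s B) ×
    ((∀ s → Trace p s → Trace q s) × (∀ s → Trace q s → Trace p s)) ×
    ((∃ λ p' → p —[ τ ]→ p') → (∃ λ q' → q —[ τ ]→ q'))

  _≡WIF_ : Term A → Term A → Set₁
  p ≡WIF q = (p ⊑WIF q) × (q ⊑WIF p)

  _≡WIFₒ_ : Term A → Term A → Set₁
  t ≡WIFₒ u = ∀ σ → ClosedSubst σ → (t [ σ ]) ≡WIF (u [ σ ])

-- Let ρ be σ with every deadlock of σ y that is reached after at most m visible
-- actions inside σ y replaced by a^(m+1).  In t[σ] a padded deadlock is reached
-- after at most depth t + m < 2m actions (depth t = depth u, by comparing the traces
-- of t and u under the substitution by 𝟎), whereas every deadlock below p' lies 2m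
-- actions deep; so the reduct of t[ρ] matching p' has only traces of length ≤ 2m.
-- By WIF-equivalence u[ρ] has a τ-reduct Q with the same property.  The matching
-- reduct q of u[σ] cannot have the completed trace a^m: its deadlock would lie inside
-- some σ y (depth u < m) and be padded, giving Q a trace of length 2m+1.  Finally
-- u[σ] can do a τ-step since t[σ] can, so some τ-reduct q' of u[σ] has
-- CT(q') ⊆ CT(q) ⊆ {a^m, a^2m} minus a^m, and CT(q') is nonempty.
module Submission where

open import Defs
open import Data.Bool using (Bool; true; false; _∨_; not; if_then_else_; T)
open import Data.Bool.Properties using (∨-zeroʳ)
open import Data.Empty using (⊥-elim)
open import Data.List using ([]; _∷_; replicate; length; _++_)
open import Data.List.Properties using (length-replicate; length-++)
open import Data.Nat using (ℕ; zero; suc; _+_; _*_; _<_; _≤_; _≤ᵇ_; z≤n; s≤s)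
open import Data.Nat.Properties
open import Data.Product using (∃; _×_; _,_; proj₁; proj₂)
open import Data.Sum using (_⊎_; inj₁; inj₂)
open import Data.Unit using (tt)
open import Function.Base using (_∘_)
open import Function.Bundles using (_⇔_; mk⇔; Equivalence)
open import Relation.Binary.PropositionalEquality hiding ([_])
open import Relation.Nullary using (¬_)

module _ {A : Set} where

  ⇒-trans : ∀ {p q r : Term A} → p ⇒ q → q ⇒ r → p ⇒ r
  ⇒-trans ⇒-refl y = y
  ⇒-trans (⇒-step st x) y = ⇒-step st (⇒-trans x y)

  ⇒τ→⇒⇒ : ∀ {p q : Term A} → p ⇒τ→ q → p ⇒ q
  ⇒τ→⇒⇒ (_ , x , st) = ⇒-trans x (⇒-step st ⇒-refl)

  ⇒τ→-first-τ : ∀ {p q : Term A} → p ⇒τ→ q → ∃ λ p₁ → p —[ τ ]→ p₁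
  ⇒τ→-first-τ (_ , ⇒-refl , st) = _ , st
  ⇒τ→-first-τ (_ , ⇒-step st _ , _) = _ , st

  —τ→⇒⇒τ→ : ∀ {p p₁ q : Term A} → p —[ τ ]→ p₁ → p₁ ⇒ q → p ⇒τ→ q
  —τ→⇒⇒τ→ st ⇒-refl = _ , ⇒-refl , st
  —τ→⇒⇒τ→ st (⇒-step st' x) with —τ→⇒⇒τ→ st' x
  ... | v , y , st'' = v , ⇒-step st y , st''

  prepend-⇒ : ∀ {p q r : Term A} {s} → p ⇒ q → WPath q s r → WPath p s r
  prepend-⇒ x (wnil y) = wnil (⇒-trans x y)
  prepend-⇒ x (wcons y st π) = wcons (⇒-trans x y) st π

  prepend-τ : ∀ {p q r : Term A} {s} → p —[ τ ]→ q → WPath q s r → WPath p s r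
  prepend-τ st = prepend-⇒ (⇒-step st ⇒-refl)

  WPath-++ : ∀ {p q r : Term A} {s w} → WPath p s q → WPath q w r → WPath p (s ++ w) r
  WPath-++ (wnil x) π = prepend-⇒ x π
  WPath-++ (wcons x st π) π' = wcons x st (WPath-++ π π')

  WPath⇒Init : ∀ {p r : Term A} {b s} → WPath p (b ∷ s) r → Init p b
  WPath⇒Init (wcons x st _) = _ , _ , x , st

  ⇒-CTrace : ∀ {p q : Term A} {s} → p ⇒ q → CTrace q s → CTrace p s
  ⇒-CTrace x (r , π , d) = r , prepend-⇒ x π , d

  ⇒-⊕ˡ : ∀ {p q r : Term A} → p ⇒ r → r ≡ p ⊎ (p ⊕ q) ⇒ r
  ⇒-⊕ˡ ⇒-refl = inj₁ refl
  ⇒-⊕ˡ (⇒-step st x) = inj₂ (⇒-step (sumˡ st) x)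

  ⇒-⊕ʳ : ∀ {p q r : Term A} → p ⇒ r → r ≡ p ⊎ (q ⊕ p) ⇒ r
  ⇒-⊕ʳ ⇒-refl = inj₁ refl
  ⇒-⊕ʳ (⇒-step st x) = inj₂ (⇒-step (sumʳ st) x)

  Init-⊕ˡ : ∀ {p q : Term A} {b} → Init p b → Init (p ⊕ q) b
  Init-⊕ˡ (_ , _ , x , st) with ⇒-⊕ˡ x
  ... | inj₁ refl = _ , _ , ⇒-refl , sumˡ st
  ... | inj₂ x' = _ , _ , x' , st

  Init-⊕ʳ : ∀ {p q : Term A} {b} → Init p b → Init (q ⊕ p) b
  Init-⊕ʳ (_ , _ , x , st) with ⇒-⊕ʳ x
  ... | inj₁ refl = _ , _ , ⇒-refl , sumʳ st
  ... | inj₂ x' = _ , _ , x' , st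

  WPath-⊕ˡ : ∀ {p q r : Term A} {s} → WPath p s r → (s ≡ [] × r ≡ p) ⊎ WPath (p ⊕ q) s r
  WPath-⊕ˡ (wnil x) with ⇒-⊕ˡ x
  ... | inj₁ r≡p = inj₁ (refl , r≡p)
  ... | inj₂ x' = inj₂ (wnil x')
  WPath-⊕ˡ (wcons x st π) with ⇒-⊕ˡ x
  ... | inj₁ refl = inj₂ (wcons ⇒-refl (sumˡ st) π)
  ... | inj₂ x' = inj₂ (wcons x' st π)

  WPath-⊕ʳ : ∀ {p q r : Term A} {s} → WPath p s r → (s ≡ [] × r ≡ p) ⊎ WPath (q ⊕ p) s r
  WPath-⊕ʳ (wnil x) with ⇒-⊕ʳ x
  ... | inj₁ r≡p = inj₁ (refl , r≡p)
  ... | inj₂ x' = inj₂ (wnil x')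
  WPath-⊕ʳ (wcons x st π) with ⇒-⊕ʳ x
  ... | inj₁ refl = inj₂ (wcons ⇒-refl (sumʳ st) π)
  ... | inj₂ x' = inj₂ (wcons x' st π)

  Trace-⊕ˡ : ∀ {p q : Term A} {s} → Trace p s → Trace (p ⊕ q) s
  Trace-⊕ˡ (_ , π) with WPath-⊕ˡ π
  ... | inj₁ (refl , _) = _ , wnil ⇒-refl
  ... | inj₂ π' = _ , π'

  Trace-⊕ʳ : ∀ {p q : Term A} {s} → Trace p s → Trace (q ⊕ p) s
  Trace-⊕ʳ (_ , π) with WPath-⊕ʳ π
  ... | inj₁ (refl , _) = _ , wnil ⇒-refl
  ... | inj₂ π' = _ , π'

  ⊑WIF-WIF : ∀ {p q : Term A} {s B} → p ⊑WIF q → WIF p s B → WIF q s B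
  ⊑WIF-WIF p⊑q = proj₁ p⊑q _ _

  ⊑WIF-Trace : ∀ {p q : Term A} {s} → p ⊑WIF q → Trace p s → Trace q s
  ⊑WIF-Trace p⊑q = proj₁ (proj₁ (proj₂ p⊑q)) _

  ⊑WIF-τ : ∀ {p q : Term A} → p ⊑WIF q → (∃ λ p' → p —[ τ ]→ p') → ∃ λ q' → q —[ τ ]→ q'
  ⊑WIF-τ p⊑q = proj₂ (proj₂ p⊑q)

  live : Term A → Bool
  live 𝟎 = false
  live (τ · p) = live p
  live (vis b · p) = true
  live (p ⊕ q) = live p ∨ live q
  live (var x) = false

  Deadlocked : Term A → Set
  Deadlocked p = ∀ b → ¬ Init p b

  live-vis : ∀ {p p' : Term A} {b} → p —[ vis b ]→ p' → live p ≡ true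
  live-vis pre = refl
  live-vis (sumˡ st) rewrite live-vis st = refl
  live-vis {u ⊕ _} (sumʳ st) rewrite live-vis st = ∨-zeroʳ (live u)

  live-τ⁻¹ : ∀ {p p' : Term A} → p —[ τ ]→ p' → live p' ≡ true → live p ≡ true
  live-τ⁻¹ pre h = h
  live-τ⁻¹ (sumˡ st) h rewrite live-τ⁻¹ st h = refl
  live-τ⁻¹ {u ⊕ _} (sumʳ st) h rewrite live-τ⁻¹ st h = ∨-zeroʳ (live u)

  live-⇒⁻¹ : ∀ {p p' : Term A} → p ⇒ p' → live p' ≡ true → live p ≡ true
  live-⇒⁻¹ ⇒-refl h = h
  live-⇒⁻¹ (⇒-step st x) h = live-τ⁻¹ st (live-⇒⁻¹ x h)

  Init⇒live : ∀ {p : Term A} {b} → Init p b → live p ≡ true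
  Init⇒live (_ , _ , x , st) = live-⇒⁻¹ x (live-vis st)

  live⇒Init : ∀ p → live p ≡ true → ∃ λ b → Init p b
  live⇒Init (τ · p) h with live⇒Init p h
  ... | b , _ , _ , x , st = b , _ , _ , ⇒-step pre x , st
  live⇒Init (vis b · p) h = b , _ , _ , ⇒-refl , pre
  live⇒Init (p ⊕ q) h with live p in e
  ... | true = let (b , i) = live⇒Init p e in b , Init-⊕ˡ i
  ... | false = let (b , i) = live⇒Init q h in b , Init-⊕ʳ i

  live⇒¬Deadlocked : ∀ {p : Term A} → live p ≡ true → ¬ Deadlocked p
  live⇒¬Deadlocked {p} h d = let (b , i) = live⇒Init p h in d b i

  ¬live⇒Deadlocked : ∀ {p : Term A} → live p ≡ false → Deadlocked p
  ¬live⇒Deadlocked e b i with trans (sym (Init⇒live i)) e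
  ... | ()

  CTrace-∷⇒live : ∀ {p : Term A} {b s} → CTrace p (b ∷ s) → live p ≡ true
  CTrace-∷⇒live (_ , π , _) = Init⇒live (WPath⇒Init π)

  CTrace-⊕ˡ : ∀ {p q : Term A} {s} → live p ≡ true → CTrace p s → CTrace (p ⊕ q) s
  CTrace-⊕ˡ h (r , π , d) with WPath-⊕ˡ π
  ... | inj₁ (_ , refl) = ⊥-elim (live⇒¬Deadlocked h d)
  ... | inj₂ π' = r , π' , d

  CTrace-⊕ʳ : ∀ {p q : Term A} {s} → live p ≡ true → CTrace p s → CTrace (q ⊕ p) s
  CTrace-⊕ʳ h (r , π , d) with WPath-⊕ʳ π
  ... | inj₁ (_ , refl) = ⊥-elim (live⇒¬Deadlocked h d)
  ... | inj₂ π' = r , π' , d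

  CTrace-exists : ∀ p → ∃ λ s → CTrace p s
  CTrace-exists 𝟎 = [] , 𝟎 , wnil ⇒-refl , ¬live⇒Deadlocked refl
  CTrace-exists (τ · p) with CTrace-exists p
  ... | s , r , π , d = s , r , prepend-τ pre π , d
  CTrace-exists (vis b · p) with CTrace-exists p
  ... | s , r , π , d = b ∷ s , r , wcons ⇒-refl pre π , d
  CTrace-exists (p ⊕ q) with live p in e₁ | live q in e₂
  ... | true | _ = let (s , c) = CTrace-exists p in s , CTrace-⊕ˡ e₁ c
  ... | false | true = let (s , c) = CTrace-exists q in s , CTrace-⊕ʳ e₂ c
  ... | false | false = [] , _ , wnil ⇒-refl , ¬live⇒Deadlocked (cong₂ _∨_ e₁ e₂)
  CTrace-exists (var x) = [] , var x , wnil ⇒-refl , ¬live⇒Deadlocked refl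

  ⇒τ→-with-CTrace-⊆ : ∀ {p q : Term A} → p ⇒ q → (∃ λ p₁ → p —[ τ ]→ p₁) →
    ∃ λ q' → (p ⇒τ→ q') × (∀ s → CTrace q' s → CTrace q s)
  ⇒τ→-with-CTrace-⊆ (⇒-step st x) _ = _ , —τ→⇒⇒τ→ st x , λ _ c → c
  ⇒τ→-with-CTrace-⊆ ⇒-refl (q₁ , st) = q₁ , (_ , ⇒-refl , st) , λ _ → ⇒-CTrace (⇒-step st ⇒-refl)

  CTrace-only : ∀ {p : Term A} {x y} → (∀ s → CTrace p s → s ≡ x ⊎ s ≡ y) → ¬ CTrace p x →
    ∀ s → CTrace p s ⇔ (s ≡ y)
  CTrace-only {p} {x} {y} ⊆xy ¬x s = mk⇔ (only s) from
    where
    only : ∀ s → CTrace p s → s ≡ y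
    only s c with ⊆xy s c
    ... | inj₁ refl = ⊥-elim (¬x c)
    ... | inj₂ e = e
    from : s ≡ y → CTrace p s
    from refl = let (s₀ , c₀) = CTrace-exists p in subst (CTrace p) (only s₀ c₀) c₀

  Closed-step : ∀ {p p' : Term A} {α} → Closed p → p —[ α ]→ p' → Closed p'
  Closed-step c pre = c
  Closed-step (c , _) (sumˡ st) = Closed-step c st
  Closed-step (_ , c) (sumʳ st) = Closed-step c st

  Closed-⇒ : ∀ {p p' : Term A} → Closed p → p ⇒ p' → Closed p'
  Closed-⇒ c ⇒-refl = c
  Closed-⇒ c (⇒-step st x) = Closed-⇒ (Closed-step c st) x

  Closed-[] : ∀ {σ : Subst} → ClosedSubst σ → ∀ (v : Term A) → Closed (v [ σ ])
  Closed-[] cσ 𝟎 = tt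
  Closed-[] cσ (α · v) = Closed-[] cσ v
  Closed-[] cσ (v ⊕ w) = Closed-[] cσ v , Closed-[] cσ w
  Closed-[] cσ (var x) = cσ x

  data TopVar (y : Var) : Term A → Set where
    here : TopVar y (var y)
    ⊕ˡ   : ∀ {v w} → TopVar y v → TopVar y (v ⊕ w)
    ⊕ʳ   : ∀ {v w} → TopVar y w → TopVar y (v ⊕ w)

  step-[] : ∀ (σ : Subst) {v v' : Term A} {α} → v —[ α ]→ v' → (v [ σ ]) —[ α ]→ (v' [ σ ])
  step-[] σ pre = pre
  step-[] σ (sumˡ st) = sumˡ (step-[] σ st)
  step-[] σ (sumʳ st) = sumʳ (step-[] σ st)

  TopVar-step : ∀ (σ : Subst) {y} {v p : Term A} {α} → TopVar y v → σ y —[ α ]→ p →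
    (v [ σ ]) —[ α ]→ p
  TopVar-step σ here st = st
  TopVar-step σ (⊕ˡ y∈v) st = sumˡ (TopVar-step σ y∈v st)
  TopVar-step σ (⊕ʳ y∈v) st = sumʳ (TopVar-step σ y∈v st)

  step-[]⁻¹ : ∀ (σ : Subst) (v : Term A) {α p} → (v [ σ ]) —[ α ]→ p →
    (∃ λ v' → (v —[ α ]→ v') × (p ≡ v' [ σ ])) ⊎ (∃ λ y → TopVar y v × (σ y —[ α ]→ p))
  step-[]⁻¹ σ (α · v) pre = inj₁ (v , pre , refl)
  step-[]⁻¹ σ (v ⊕ w) (sumˡ st) with step-[]⁻¹ σ v st
  ... | inj₁ (v' , st' , e) = inj₁ (v' , sumˡ st' , e)
  ... | inj₂ (y , y∈v , st') = inj₂ (y , ⊕ˡ y∈v , st')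
  step-[]⁻¹ σ (v ⊕ w) (sumʳ st) with step-[]⁻¹ σ w st
  ... | inj₁ (w' , st' , e) = inj₁ (w' , sumʳ st' , e)
  ... | inj₂ (y , y∈w , st') = inj₂ (y , ⊕ʳ y∈w , st')
  step-[]⁻¹ σ (var x) st = inj₂ (x , here , st)

  tick : Act A → ℕ → ℕ
  tick τ k = k
  tick (vis _) k = suc k

  +-tick : ∀ α d k → d + tick α k ≡ tick α (d + k)
  +-tick τ d k = refl
  +-tick (vis _) d k = +-suc d k

  tick-+ : ∀ α d k → tick α d + k ≡ tick α (d + k)
  tick-+ τ d k = refl
  tick-+ (vis _) d k = refl

  depth-step : ∀ {v v' : Term A} {α} → v —[ α ]→ v' → tick α (depth v') ≤ depth v
  depth-step {α = τ} pre = ≤-refl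
  depth-step {α = vis _} pre = ≤-refl
  depth-step {v ⊕ w} (sumˡ st) = ≤-trans (depth-step st) (m≤m⊔n (depth v) (depth w))
  depth-step {w ⊕ v} (sumʳ st) = ≤-trans (depth-step st) (m≤n⊔m (depth w) (depth v))

  σ𝟎 : Subst {A}
  σ𝟎 _ = 𝟎

  step-σ𝟎 : ∀ (v : Term A) {α p} → (v [ σ𝟎 ]) —[ α ]→ p →
    ∃ λ v' → p ≡ v' [ σ𝟎 ] × tick α (depth v') ≤ depth v
  step-σ𝟎 v st with step-[]⁻¹ σ𝟎 v st
  ... | inj₁ (v' , st' , e) = v' , e , depth-step st'
  ... | inj₂ (_ , _ , ())

  ⇒-σ𝟎 : ∀ (v : Term A) {p} → (v [ σ𝟎 ]) ⇒ p → ∃ λ v' → p ≡ v' [ σ𝟎 ] × depth v' ≤ depth v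
  ⇒-σ𝟎 v ⇒-refl = v , refl , ≤-refl
  ⇒-σ𝟎 v (⇒-step st x) with step-σ𝟎 v st
  ... | v₁ , refl , le with ⇒-σ𝟎 v₁ x
  ...   | v' , e , le' = v' , e , ≤-trans le' le

  WPath-σ𝟎-≤-depth : ∀ (v : Term A) {w r} → WPath (v [ σ𝟎 ]) w r → length w ≤ depth v
  WPath-σ𝟎-≤-depth v (wnil _) = z≤n
  WPath-σ𝟎-≤-depth v (wcons x st π) with ⇒-σ𝟎 v x
  ... | v₁ , refl , le with step-σ𝟎 v₁ st
  ...   | v₂ , refl , le' = ≤-trans (s≤s (WPath-σ𝟎-≤-depth v₂ π)) (≤-trans le' le)

  depth-≤-Trace-σ𝟎 : ∀ (v : Term A) → ∃ λ w → Trace (v [ σ𝟎 ]) w × depth v ≤ length w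
  depth-≤-Trace-σ𝟎 𝟎 = [] , (𝟎 , wnil ⇒-refl) , z≤n
  depth-≤-Trace-σ𝟎 (τ · v) with depth-≤-Trace-σ𝟎 v
  ... | w , (r , π) , le = w , (r , prepend-τ pre π) , le
  depth-≤-Trace-σ𝟎 (vis b · v) with depth-≤-Trace-σ𝟎 v
  ... | w , (r , π) , le = b ∷ w , (r , wcons ⇒-refl pre π) , s≤s le
  depth-≤-Trace-σ𝟎 (v ⊕ v') with ≤-total (depth v') (depth v)
  ... | inj₁ le = let (w , tr , l) = depth-≤-Trace-σ𝟎 v in
        w , Trace-⊕ˡ tr , subst (_≤ length w) (sym (m≥n⇒m⊔n≡m le)) l
  ... | inj₂ le = let (w , tr , l) = depth-≤-Trace-σ𝟎 v' in
        w , Trace-⊕ʳ tr , subst (_≤ length w) (sym (m≤n⇒m⊔n≡n le)) l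
  depth-≤-Trace-σ𝟎 (var x) = [] , (𝟎 , wnil ⇒-refl) , z≤n

  depth-mono-Trace-σ𝟎 : ∀ {t u : Term A} → (∀ s → Trace (t [ σ𝟎 ]) s → Trace (u [ σ𝟎 ]) s) →
    depth t ≤ depth u
  depth-mono-Trace-σ𝟎 {t} {u} t⊆u with depth-≤-Trace-σ𝟎 t
  ... | w , tr , le = ≤-trans le (WPath-σ𝟎-≤-depth u (proj₂ (t⊆u w tr)))

  ≡WIFₒ-depth : ∀ {t u : Term A} → t ≡WIFₒ u → depth t ≡ depth u
  ≡WIFₒ-depth {t} {u} t≡u with t≡u σ𝟎 (λ _ → tt)
  ... | t⊑u , u⊑t = ≤-antisym (depth-mono-Trace-σ𝟎 {t} {u} (λ _ → ⊑WIF-Trace t⊑u))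
                              (depth-mono-Trace-σ𝟎 {u} {t} (λ _ → ⊑WIF-Trace u⊑t))

module Padding {A : Set} (σ : Subst {A}) (a : A) (m : ℕ) where

  a^_ : ℕ → Term A
  a^ zero = 𝟎
  a^ suc n = vis a · a^ n

  a^-WPath : ∀ n → WPath (a^ n) (replicate n a) 𝟎
  a^-WPath zero = wnil ⇒-refl
  a^-WPath (suc n) = wcons ⇒-refl pre (a^-WPath n)

  -- k counts the visible actions already performed inside the padded term.
  mutual
    padNext : ℕ → Term A → Term A
    padNext k 𝟎 = 𝟎
    padNext k (α · p) = α · pad (tick α k) p
    padNext k (p ⊕ q) = padNext k p ⊕ padNext k q
    padNext k (var x) = var x

    pad : ℕ → Term A → Term A
    pad k p = if live p ∨ not (k ≤ᵇ m) then padNext k p else a^ suc m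

  padded : Subst
  padded y = padNext 0 (σ y)

  pad-live : ∀ {k} {p : Term A} → live p ≡ true → pad k p ≡ padNext k p
  pad-live e rewrite e = refl

  pad-dead : ∀ {k} {p : Term A} → live p ≡ false → k ≤ m → pad k p ≡ a^ suc m
  pad-dead {k} e k≤m rewrite e with k ≤ᵇ m | ≤⇒≤ᵇ k≤m
  ... | true | _ = refl

  pad-cases : ∀ k (p : Term A) → pad k p ≡ padNext k p ⊎ (live p ≡ false × k ≤ m × pad k p ≡ a^ suc m)
  pad-cases k p with live p in e | k ≤ᵇ m in e₂
  ... | true | _ = inj₁ refl
  ... | false | false = inj₁ refl
  ... | false | true = inj₂ (refl , ≤ᵇ⇒≤ k m (subst T (sym e₂) tt) , refl)

  padNext-step : ∀ {k} {p p' : Term A} {α} → p —[ α ]→ p' → padNext k p —[ α ]→ pad (tick α k) p'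
  padNext-step pre = pre
  padNext-step (sumˡ st) = sumˡ (padNext-step st)
  padNext-step (sumʳ st) = sumʳ (padNext-step st)

  padNext-step⁻¹ : ∀ {k} (p : Term A) {α P'} → padNext k p —[ α ]→ P' →
    ∃ λ p' → (p —[ α ]→ p') × (P' ≡ pad (tick α k) p')
  padNext-step⁻¹ (α · p) pre = p , pre , refl
  padNext-step⁻¹ (p ⊕ q) (sumˡ st) with padNext-step⁻¹ p st
  ... | p' , st' , e = p' , sumˡ st' , e
  padNext-step⁻¹ (p ⊕ q) (sumʳ st) with padNext-step⁻¹ q st
  ... | q' , st' , e = q' , sumʳ st' , e

  Closed-a^ : ∀ n → Closed (a^ n)
  Closed-a^ zero = tt
  Closed-a^ (suc n) = Closed-a^ n

  mutual
    Closed-padNext : ∀ k (p : Term A) → Closed p → Closed (padNext k p)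
    Closed-padNext k 𝟎 c = tt
    Closed-padNext k (α · p) c = Closed-pad (tick α k) p c
    Closed-padNext k (p ⊕ q) (c₁ , c₂) = Closed-padNext k p c₁ , Closed-padNext k q c₂

    Closed-pad : ∀ k (p : Term A) → Closed p → Closed (pad k p)
    Closed-pad k p c with pad-cases k p
    ... | inj₁ e = subst Closed (sym e) (Closed-padNext k p c)
    ... | inj₂ (_ , _ , e) = subst Closed (sym e) (Closed-a^ (suc m))

  padded-closed : ClosedSubst σ → ClosedSubst padded
  padded-closed cσ y = Closed-padNext 0 (σ y) (cσ y)

  -- j counts the visible actions performed so far; in `inner`, d of them were
  -- performed by the outer term before entering some σ y, and k inside it.
  data Related (D : ℕ) : ℕ → Term A → Term A → Set where
    outer : ∀ {j} v → depth v + j ≤ D → Related D j (v [ σ ]) (v [ padded ])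
    inner : ∀ {j} d k p → d + k ≡ j → d ≤ D → Related D j p (pad k p)

  Related-start : ∀ v → Related (depth v) 0 (v [ σ ]) (v [ padded ])
  Related-start v = outer v (≤-reflexive (+-identityʳ (depth v)))

  outer-step : ∀ {D j} {v v' : Term A} {α} → v —[ α ]→ v' → depth v + j ≤ D → depth v' + tick α j ≤ D
  outer-step {D} {j} {v} {v'} {α} st le = begin
    depth v' + tick α j   ≡⟨ +-tick α (depth v') j ⟩
    tick α (depth v' + j) ≡⟨ sym (tick-+ α (depth v') j) ⟩
    tick α (depth v') + j ≤⟨ +-monoˡ-≤ j (depth-step st) ⟩
    depth v + j           ≤⟨ le ⟩
    D                     ∎
    where open ≤-Reasoning

  enter : ∀ {D j} (v : Term A) {α : Act A} (p : Term A) → depth v + j ≤ D →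
    Related D (tick α j) p (pad (tick α 0) p)
  enter {j = j} v {α} p le =
    inner j (tick α 0) p (trans (+-tick α j 0) (cong (tick α) (+-identityʳ j))) (≤-trans (m≤n+m j (depth v)) le)

  Related-step : ∀ {D j} {q Q q' : Term A} {α} → Related D j q Q → live q ≡ true → q —[ α ]→ q' →
    ∃ λ Q' → (Q —[ α ]→ Q') × Related D (tick α j) q' Q'
  Related-step (outer v le) _ st with step-[]⁻¹ σ v st
  ... | inj₁ (v' , st' , refl) = _ , step-[] padded st' , outer v' (outer-step st' le)
  ... | inj₂ (y , y∈v , st') = _ , TopVar-step padded y∈v (padNext-step st') , enter v _ le
  Related-step {α = α} (inner d k p e le) h st =
    _ , subst (λ P → P —[ α ]→ _) (sym (pad-live h)) (padNext-step st) ,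
    inner d (tick α k) _ (trans (+-tick α d k) (cong (tick α) e)) le

  Related-step⁻¹ : ∀ {D j} {q Q Q' : Term A} {α} → Related D j q Q → Q —[ α ]→ Q' →
    (∃ λ q' → (q —[ α ]→ q') × Related D (tick α j) q' Q') ⊎
    (live q ≡ false × j ≤ D + m × Q ≡ a^ suc m)
  Related-step⁻¹ (outer v le) st with step-[]⁻¹ padded v st
  ... | inj₁ (v' , st' , refl) = inj₁ (_ , step-[] σ st' , outer v' (outer-step st' le))
  ... | inj₂ (y , y∈v , st') with padNext-step⁻¹ (σ y) st'
  ...   | p' , st'' , refl = inj₁ (p' , TopVar-step σ y∈v st'' , enter v p' le)
  Related-step⁻¹ {α = α} (inner d k p e le) st with pad-cases k p
  ... | inj₁ g with padNext-step⁻¹ p (subst (λ P → P —[ α ]→ _) g st)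
  ...   | p' , st' , refl = inj₁ (p' , st' , inner d (tick α k) p' (trans (+-tick α d k) (cong (tick α) e)) le)
  Related-step⁻¹ (inner d k p e le) st | inj₂ (dead , k≤m , g) =
    inj₂ (dead , subst (_≤ _ + m) e (+-mono-≤ le k≤m) , g)

  Related-⇒ : ∀ {D j} {q Q q' : Term A} → Related D j q Q → q ⇒ q' → live q' ≡ true →
    ∃ λ Q' → (Q ⇒ Q') × Related D j q' Q'
  Related-⇒ rel ⇒-refl _ = _ , ⇒-refl , rel
  Related-⇒ rel (⇒-step st x) h with Related-step rel (live-τ⁻¹ st (live-⇒⁻¹ x h)) st
  ... | Q₁ , st' , rel₁ = let (Q' , x' , rel') = Related-⇒ rel₁ x h in Q' , ⇒-step st' x' , rel'

  -- a^(m+1) has no τ-step, so the padding never obstructs matching τ-steps back.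
  Related-⇒⁻¹ : ∀ {D j} {q Q Q' : Term A} → Related D j q Q → Q ⇒ Q' →
    ∃ λ q' → (q ⇒ q') × Related D j q' Q'
  Related-⇒⁻¹ rel ⇒-refl = _ , ⇒-refl , rel
  Related-⇒⁻¹ rel (⇒-step st x) with Related-step⁻¹ rel st
  ... | inj₁ (q₁ , st' , rel₁) = let (q' , x' , rel') = Related-⇒⁻¹ rel₁ x in q' , ⇒-step st' x' , rel'
  ... | inj₂ (_ , _ , refl) with st
  ...   | ()

  dead-end : ∀ {D j} {q Q : Term A} → D < m → Related D j q Q → live q ≡ false → j ≡ m →
    WPath Q (replicate (suc m) a) 𝟎
  dead-end D<m (outer v le) _ refl = ⊥-elim (<⇒≱ D<m (≤-trans (m≤n+m m (depth v)) le))
  dead-end _ (inner d k p e _) dead refl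
    rewrite pad-dead {k} {p} dead (subst (k ≤_) e (m≤n+m k d)) = a^-WPath (suc m)

  Related-⇒-dead : ∀ {D j} {q Q r : Term A} → Related D j q Q → q ⇒ r → Deadlocked r →
    ∃ λ q' → ∃ λ Q' → (Q ⇒ Q') × Related D j q' Q' × live q' ≡ false
  Related-⇒-dead {q = q} rel x d with live q in e
  ... | false = _ , _ , ⇒-refl , rel , e
  Related-⇒-dead rel ⇒-refl d | true = ⊥-elim (live⇒¬Deadlocked e d)
  Related-⇒-dead rel (⇒-step st x) d | true with Related-step rel e st
  ... | _ , st' , rel₁ =
    let (q' , Q' , x' , rel' , dead) = Related-⇒-dead rel₁ x d in q' , Q' , ⇒-step st' x' , rel' , dead

  -- The completed trace w of q reaches its deadlock inside some σ y after exactly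
  -- m visible actions, where the padding appends a^(m+1).
  WPath-padded : ∀ {D j} {q Q r : Term A} {w} → D < m → Related D j q Q → WPath q w r → Deadlocked r →
    j + length w ≡ m → Trace Q (w ++ replicate (suc m) a)
  WPath-padded D<m rel (wnil x) d e with Related-⇒-dead rel x d
  ... | _ , _ , x' , rel' , dead = 𝟎 , prepend-⇒ x' (dead-end D<m rel' dead (trans (sym (+-identityʳ _)) e))
  WPath-padded D<m rel (wcons x st π) d e with Related-⇒ rel x (live-vis st)
  ... | _ , x' , rel₁ with Related-step rel₁ (live-vis st) st
  ...   | _ , st' , rel₂ with WPath-padded D<m rel₂ π d (trans (sym (+-suc _ _)) e)
  ...     | R , π' = R , wcons x' st' π'

  unpadded-no-short : ∀ u → depth u < m → WIF (u [ padded ]) [] (λ w → 2 * m < length w) →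
    ∃ λ q → (u [ σ ]) ⇒ q × ¬ CTrace q (replicate m a)
  unpadded-no-short u du<m (Q , wnil U⇒Q , bounded) with Related-⇒⁻¹ (Related-start u) U⇒Q
  ... | q , u⇒q , rel = q , u⇒q , λ (r , π , d) →
    bounded _ (WPath-padded du<m rel π d (length-replicate m)) (≤-reflexive (sym length-a^m++a^m+1))
    where
    open ≡-Reasoning
    length-a^m++a^m+1 : length (replicate m a ++ replicate (suc m) a) ≡ suc (2 * m)
    length-a^m++a^m+1 = begin
      length (replicate m a ++ replicate (suc m) a)
        ≡⟨ length-++ (replicate m a) ⟩
      length (replicate m a) + length (replicate (suc m) a)
        ≡⟨ cong₂ _+_ (length-replicate m) (length-replicate (suc m)) ⟩
      m + suc m
        ≡⟨ +-suc m m ⟩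
      suc (m + m)
        ≡⟨ cong (λ n → suc (m + n)) (sym (+-identityʳ m)) ⟩
      suc (2 * m)
        ∎

  Ends : ℕ → Term A → Set
  Ends j p = ∀ w → CTrace p w → j + length w ≡ 2 * m

  Ends-step : ∀ {j} {p p' : Term A} {α} → Ends j p → p —[ α ]→ p' → Ends (tick α j) p'
  Ends-step {α = τ} ends st w (r , π , d) = ends w (r , prepend-τ st π , d)
  Ends-step {j} {α = vis b} ends st w (r , π , d) =
    trans (sym (+-suc j (length w))) (ends (b ∷ w) (r , wcons ⇒-refl st π , d))

  Ends-⇒ : ∀ {j} {p p' : Term A} → Ends j p → p ⇒ p' → Ends j p'
  Ends-⇒ ends ⇒-refl = ends
  Ends-⇒ ends (⇒-step st x) = Ends-⇒ (Ends-step ends st) x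

  -- A padded deadlock would be reached after at most D + m < 2m visible actions.
  Related-step⁻¹-Ends : ∀ {D j} {p P P' : Term A} {α} → D < m → Related D j p P → Ends j p →
    P —[ α ]→ P' →
    ∃ λ p' → (p —[ α ]→ p') × Related D (tick α j) p' P'
  Related-step⁻¹-Ends {D} {j} {p} D<m rel ends st with Related-step⁻¹ rel st
  ... | inj₁ r = r
  ... | inj₂ (dead , j≤D+m , _) = ⊥-elim (<⇒≱ (+-monoˡ-< m D<m) (subst (_≤ D + m) j≡m+m j≤D+m))
    where
    open ≡-Reasoning
    j≡m+m : j ≡ m + m
    j≡m+m = begin
      j      ≡⟨ sym (+-identityʳ j) ⟩
      j + 0  ≡⟨ ends [] (p , wnil ⇒-refl , ¬live⇒Deadlocked dead) ⟩
      2 * m  ≡⟨ cong (m +_) (+-identityʳ m) ⟩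
      m + m  ∎

  WPath-padded⁻¹ : ∀ {D j} {p P R : Term A} {w} → D < m → Related D j p P → Ends j p → WPath P w R →
    ∃ λ r → WPath p w r
  WPath-padded⁻¹ _ rel _ (wnil x) = let (r , x' , _) = Related-⇒⁻¹ rel x in r , wnil x'
  WPath-padded⁻¹ D<m rel ends (wcons x st π) with Related-⇒⁻¹ rel x
  ... | _ , x' , rel₁ with Related-step⁻¹-Ends D<m rel₁ (Ends-⇒ ends x') st
  ...   | _ , st' , rel₂ =
    let (r , π') = WPath-padded⁻¹ D<m rel₂ (Ends-step (Ends-⇒ ends x') st') π in r , wcons x' st' π'

  Trace-padded-≤ : ∀ {D j} {p P : Term A} {w} → D < m → Related D j p P → Ends j p → Trace P w →
    j + length w ≤ 2 * m
  Trace-padded-≤ {j = j} {w = w} D<m rel ends (_ , π) with WPath-padded⁻¹ D<m rel ends π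
  ... | r , π' with CTrace-exists r
  ...   | s , r' , π'' , d = begin
    j + length w               ≤⟨ +-monoʳ-≤ j (m≤m+n (length w) (length s)) ⟩
    j + (length w + length s)  ≡⟨ cong (j +_) (sym (length-++ w)) ⟩
    j + length (w ++ s)        ≡⟨ ends (w ++ s) (r' , WPath-++ π' π'' , d) ⟩
    2 * m                      ∎
    where open ≤-Reasoning

  padded-WIF : ∀ t {p' : Term A} → depth t < m → (t [ σ ]) ⇒τ→ p' → live p' ≡ true → Ends 0 p' →
    WIF (t [ padded ]) [] (λ w → 2 * m < length w)
  padded-WIF t dt<m (_ , t⇒v , v→p') p'-live ends
    with Related-⇒ (Related-start t) t⇒v (live-τ⁻¹ v→p' p'-live)
  ... | _ , T⇒V , relV with Related-step relV (live-τ⁻¹ v→p' p'-live) v→p'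
  ...   | P , V→P , relP =
    P , wnil (⇒-trans T⇒V (⇒-step V→P ⇒-refl)) , λ _ tr → ≤⇒≯ (Trace-padded-≤ dt<m relP ends tr)

  no-short-reduct : ∀ t u {p' : Term A} → ClosedSubst σ → t ≡WIFₒ u → depth u < m →
    (t [ σ ]) ⇒τ→ p' → live p' ≡ true → Ends 0 p' →
    ∃ λ q → (u [ σ ]) ⇒ q × ¬ CTrace q (replicate m a)
  no-short-reduct t u cσ t≡u du<m t⇒τp' p'-live ends =
    unpadded-no-short u du<m (⊑WIF-WIF (proj₁ (t≡u padded (padded-closed cσ)))
      (padded-WIF t (≤-<-trans (≤-reflexive (≡WIFₒ-depth {t = t} {u} t≡u)) du<m) t⇒τp' p'-live ends))

lemma7 : {A : Set} (t u : Term A) (σ : Subst) (a : A) (m : ℕ) →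
    ClosedSubst σ →
    t ≡WIFₒ u →
    depth u < m →
    (∀ s → CTrace (u [ σ ]) s → s ≡ replicate m a ⊎ s ≡ replicate (2 * m) a) →
    (∃ λ p' → Closed p' × ((t [ σ ]) ⇒τ→ p') × (∀ s → CTrace p' s ⇔ (s ≡ replicate (2 * m) a))) →
    ∃ λ q' → Closed q' × ((u [ σ ]) ⇒τ→ q') × (∀ s → CTrace q' s ⇔ (s ≡ replicate (2 * m) a))
lemma7 t u σ a zero _ _ () _ _
lemma7 t u σ a m@(suc _) cσ t≡u du<m CTu⊆ (p' , _ , t⇒τp' , CTp')
  with Padding.no-short-reduct σ a m t u cσ t≡u du<m t⇒τp'
         (CTrace-∷⇒live (Equivalence.from (CTp' _) refl))
         (λ w c → trans (cong length (Equivalence.to (CTp' w) c)) (length-replicate (2 * m)))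
... | q , u⇒q , no-short
  with ⇒τ→-with-CTrace-⊆ u⇒q (⊑WIF-τ (proj₁ (t≡u σ cσ)) (⇒τ→-first-τ t⇒τp'))
...   | q' , u⇒τq' , q'⊆q =
  q' , Closed-⇒ (Closed-[] cσ u) (⇒τ→⇒⇒ u⇒τq') , u⇒τq' ,
  CTrace-only (λ s → CTu⊆ s ∘ ⇒-CTrace u⇒q ∘ q'⊆q s) (no-short ∘ q'⊆q _)
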